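{- For a norm label $i$, agent $a$, temporal variables $t_b,t_v$ and state formulas $\phi,\psi$: $\psi\to\phi$ together with $M,s\models_\tau\mathrm{Viol}^{act}_{i,a}(t_b,t_v,\phi)$ does not in general imply $M,s\models_\tau\mathrm{Viol}^{act}_{i,a}(t_b,t_v,\psi)$.
   Context: Fix sets $\mathcal A$ (agents), $\mathcal T$ (temporal variables), $\mathcal I$ (norm labels), and propositional variables. State formulas include propositional variables, time comparisons $\pi_1<\pi_2$, $\pi_1=\pi_2$ (time terms $t,t+c,t-c$), Boolean connectives, $E_a\phi$, $\mathsf E\alpha$, $\mathsf A\alpha$, $t.\phi$, $V_{i,a}$, $D_{i,a}$; path formulas are built with $X^d,F^d,G^d,U^d$, $d\in\{+,-\}$. A model is $M=\langle\mathcal W,w,\mathcal R,T,\pi,V,D,R,P\rangle$ with $(\mathcal W,\mathcal R)$ a tree rooted at $w$, $T$ labelling transitions by sets of agents, $\pi$ a valuation, and for each $i,a$ a set $V(i,a)\subseteq\mathcal W$ of states where $a$ is in violation of norm $i$ (and $D,R,P$ analogous for deadline, repair, punishment). $\mathrm{depth}(s)$: depth of $s$, root depth $0$. Paths start at the root; $\sigma(j)$ the $j$-th state; $\mathrm{paths}(s)$ paths through $s$. Assignment $\tau:\mathcal T\to\mathbb N$. Semantics: $V_{i,a}$ iff $s\in V(i,a)$; $t_1<t_2+c$ iff $\tau(t_1)<\tau(t_2)+c$ (similarly $=$, $\le$, $\ge$); $t.\phi$ iff $M,s\models_{\tau[t:=\mathrm{depth}(s)]}\phi$; $E_a\phi$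 iff $\phi$ holds at every $\mathcal R$-successor of $s$, some transition $(s,s')$ has $a\in T((s,s'))$, and $M,w\models_\tau\neg\mathsf AG^+\phi$; $\mathsf E\alpha$/$\mathsf A\alpha$ iff for some/all $\sigma\in\mathrm{paths}(s)$, $M,\sigma,\mathrm{depth}(s)\models_\tau\alpha$. Paths: state formulas evaluated at $\sigma(j)$; $t.\alpha$ iff $M,\sigma,j\models_{\tau[t:=j]}\alpha$; $X^-\phi$ iff $j>0$ and $\phi$ at $\sigma(j-1)$; $F^-\phi$ iff $\phi$ at some $\sigma(i)$, $i<j$; $G^-\phi$ iff $\phi$ at all $\sigma(i)$, $i\le j$; $X^+,F^+,G^+,U^\pm$ analogously forwards/backwards. $M,s\models_\tau\mathrm{Viol}^{act}_{i,a}(t_b,t_v,\phi)$ ("$a$ violated norm $i$ at time $t_v$ by seeing to it that $\phi$, counted since $t_b$") iff $M,s\models_\tau t.(t_v=t\wedge V_{i,a}\wedge\mathsf AX^-E_a\phi)\vee\mathsf AF^-(t.(t_v=t)\wedge V_{i,a}\wedge\mathsf AX^-E_a\phi)$ and $M,s\models_\tau\mathsf AG^-t.((t\ge t_b\wedge t\le t_v)\to(\phi\to V_{i,a}))$. -}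

module Defs where

open import Data.Nat using (ℕ; zero; suc; _+_; _≤_; _<_; _⊔_; _≡ᵇ_)
open import Data.Integer as ℤ using (ℤ; +_)
open import Data.Product using (Σ; ∃; _×_; _,_)
open import Data.Sum using (_⊎_)
open import Data.Unit using (⊤)
open import Data.Empty using (⊥)
open import Data.Bool using (if_then_else_)
open import Relation.Binary.PropositionalEquality using (_≡_; _≢_)
open import Relation.Nullary using (¬_)

Agent TVar Label PVar : Set
Agent = ℕ
TVar  = ℕ
Label = ℕ
PVar  = ℕ

data TTerm : Set where
  var   : TVar → TTerm
  _⊕_   : TVar → ℕ → TTerm
  _⊖_   : TVar → ℕ → TTerm

data Dir : Set where
  fut past : Dir

mutual
  data SForm : Set where
    prop   : PVar → SForm
    _≺_    : TTerm → TTerm → SForm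
    _≐_    : TTerm → TTerm → SForm
    ⊤ᶠ     : SForm
    ¬ᶠ_    : SForm → SForm
    _∧ᶠ_   : SForm → SForm → SForm
    _∨ᶠ_   : SForm → SForm → SForm
    _⇒ᶠ_   : SForm → SForm → SForm
    Eag    : Agent → SForm → SForm
    Eᶠ     : PForm → SForm
    Aᶠ     : PForm → SForm
    bind   : TVar → SForm → SForm
    Vᶠ     : Label → Agent → SForm
    Dᶠ     : Label → Agent → SForm

  data PForm : Set where
    st     : SForm → PForm
    ¬ᵖ_    : PForm → PForm
    _∧ᵖ_   : PForm → PForm → PForm
    _∨ᵖ_   : PForm → PForm → PForm
    _⇒ᵖ_   : PForm → PForm → PForm
    Xᵖ     : Dir → PForm → PForm
    Fᵖ     : Dir → PForm → PForm
    Gᵖ     : Dir → PForm → PForm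
    Uᵖ     : Dir → PForm → PForm → PForm
    bindᵖ  : TVar → PForm → PForm

_≼_ : TTerm → TTerm → SForm
p ≼ q = (p ≺ q) ∨ᶠ (p ≐ q)

_≽_ : TTerm → TTerm → SForm
p ≽ q = q ≼ p

tvarT : TTerm → ℕ
tvarT (var t) = t
tvarT (t ⊕ _) = t
tvarT (t ⊖ _) = t

mutual
  maxVar : SForm → ℕ
  maxVar (prop _)  = 0
  maxVar (p ≺ q)   = tvarT p ⊔ tvarT q
  maxVar (p ≐ q)   = tvarT p ⊔ tvarT q
  maxVar ⊤ᶠ        = 0
  maxVar (¬ᶠ φ)    = maxVar φ
  maxVar (φ ∧ᶠ ψ)  = maxVar φ ⊔ maxVar ψ
  maxVar (φ ∨ᶠ ψ)  = maxVar φ ⊔ maxVar ψ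
  maxVar (φ ⇒ᶠ ψ)  = maxVar φ ⊔ maxVar ψ
  maxVar (Eag _ φ) = maxVar φ
  maxVar (Eᶠ α)    = maxVarP α
  maxVar (Aᶠ α)    = maxVarP α
  maxVar (bind t φ) = t ⊔ maxVar φ
  maxVar (Vᶠ _ _)  = 0
  maxVar (Dᶠ _ _)  = 0

  maxVarP : PForm → ℕ
  maxVarP (st φ)      = maxVar φ
  maxVarP (¬ᵖ α)      = maxVarP α
  maxVarP (α ∧ᵖ β)    = maxVarP α ⊔ maxVarP β
  maxVarP (α ∨ᵖ β)    = maxVarP α ⊔ maxVarP β
  maxVarP (α ⇒ᵖ β)    = maxVarP α ⊔ maxVarP β
  maxVarP (Xᵖ _ α)    = maxVarP α
  maxVarP (Fᵖ _ α)    = maxVarP α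
  maxVarP (Gᵖ _ α)    = maxVarP α
  maxVarP (Uᵖ _ α β)  = maxVarP α ⊔ maxVarP β
  maxVarP (bindᵖ t α) = t ⊔ maxVarP α

record Model : Set₁ where
  field
    W      : Set
    root   : W
    R      : W → W → Set
    depth  : W → ℕ
    depth-root    : depth root ≡ 0
    depth-step    : ∀ {s s'} → R s s' → depth s' ≡ suc (depth s)
    parent        : ∀ s → s ≢ root → ∃ λ p → R p s
    parent-unique : ∀ {p q s} → R p s → R q s → p ≡ q
    T      : W → W → Agent → Set
    val    : PVar → W → Set
    V      : Label → Agent → W → Set
    D      : Label → Agent → W → Set
    Rep    : Label → Agent → W → Set
    Pun    : Label → Agent → W → Set

record Path (M : Model) : Set where
  open Model M
  field
    σ     : ℕ → W
    start : σ 0 ≡ root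
    step  : ∀ j → R (σ j) (σ (suc j))
open Path public

_∈paths_ : {M : Model} → Path M → Model.W M → Set
p ∈paths s = ∃ λ j → σ p j ≡ s

Assignment : Set
Assignment = TVar → ℕ

_[_≔_] : Assignment → TVar → ℕ → Assignment
(τ [ t ≔ n ]) x = if x ≡ᵇ t then n else τ x

⟦_⟧ₜ : TTerm → Assignment → ℤ
⟦ var t ⟧ₜ τ = + τ t
⟦ t ⊕ c ⟧ₜ τ = + τ t ℤ.+ + c
⟦ t ⊖ c ⟧ₜ τ = + τ t ℤ.- + c

module _ (M : Model) where
  open Model M

  mutual
    Sat : W → Assignment → SForm → Set
    Sat s τ (prop p)   = val p s
    Sat s τ (p ≺ q)    = ⟦ p ⟧ₜ τ ℤ.< ⟦ q ⟧ₜ τ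
    Sat s τ (p ≐ q)    = ⟦ p ⟧ₜ τ ≡ ⟦ q ⟧ₜ τ
    Sat s τ ⊤ᶠ         = ⊤
    Sat s τ (¬ᶠ φ)     = ¬ Sat s τ φ
    Sat s τ (φ ∧ᶠ ψ)   = Sat s τ φ × Sat s τ ψ
    Sat s τ (φ ∨ᶠ ψ)   = Sat s τ φ ⊎ Sat s τ ψ
    Sat s τ (φ ⇒ᶠ ψ)   = Sat s τ φ → Sat s τ ψ
    -- E_a φ : φ at every successor, some outgoing transition labelled by a,
    -- and M,w ⊨ ¬ 𝖠 G⁺ φ (unfolded: not every root path has φ everywhere)
    Sat s τ (Eag a φ)  =
      (∀ s' → R s s' → Sat s' τ φ)
      × (∃ λ s' → R s s' × T s s' a)
      × ¬ (∀ (p : Path M) → ∀ k → Sat (σ p k) τ φ)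
    Sat s τ (Eᶠ α)     = Σ (Path M) λ p → p ∈paths s × SatP p (depth s) τ α
    Sat s τ (Aᶠ α)     = ∀ (p : Path M) → p ∈paths s → SatP p (depth s) τ α
    Sat s τ (bind t φ) = Sat s (τ [ t ≔ depth s ]) φ
    Sat s τ (Vᶠ i a)   = V i a s
    Sat s τ (Dᶠ i a)   = D i a s

    SatP : Path M → ℕ → Assignment → PForm → Set
    SatP p j τ (st φ)     = Sat (σ p j) τ φ
    SatP p j τ (¬ᵖ α)     = ¬ SatP p j τ α
    SatP p j τ (α ∧ᵖ β)   = SatP p j τ α × SatP p j τ β
    SatP p j τ (α ∨ᵖ β)   = SatP p j τ α ⊎ SatP p j τ β
    SatP p j τ (α ⇒ᵖ β)   = SatP p j τ α → SatP p j τ β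
    SatP p j τ (Xᵖ fut α) = SatP p (suc j) τ α
    SatP p zero τ (Xᵖ past α)    = ⊥
    SatP p (suc j) τ (Xᵖ past α) = SatP p j τ α
    SatP p j τ (Fᵖ fut α)  = ∃ λ i → j < i × SatP p i τ α
    SatP p j τ (Fᵖ past α) = ∃ λ i → i < j × SatP p i τ α
    SatP p j τ (Gᵖ fut α)  = ∀ i → j ≤ i → SatP p i τ α
    SatP p j τ (Gᵖ past α) = ∀ i → i ≤ j → SatP p i τ α
    SatP p j τ (Uᵖ fut α β)  =
      ∃ λ k → j ≤ k × SatP p k τ β × (∀ i → j ≤ i → i < k → SatP p i τ α)
    SatP p j τ (Uᵖ past α β) =
      ∃ λ k → k ≤ j × SatP p k τ β × (∀ i → k < i → i ≤ j → SatP p i τ α)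
    SatP p j τ (bindᵖ t α) = SatP p j (τ [ t ≔ j ]) α

Valid : SForm → Set₁
Valid φ = ∀ (M : Model) (s : Model.W M) (τ : Assignment) → Sat M s τ φ

-- Viol^act_{i,a}(t_b, t_v, φ), with the bound variable t chosen fresh
-- (distinct from t_b, t_v and from every variable of φ).

freshVar : TVar → TVar → SForm → TVar
freshVar tb tv φ = suc (tb ⊔ tv ⊔ maxVar φ)

ViolAct : (M : Model) → Model.W M → Assignment →
          Label → Agent → TVar → TVar → SForm → Set
ViolAct M s τ i a tb tv φ = let t = freshVar tb tv φ in
  Sat M s τ
    (bind t ((var tv ≐ var t) ∧ᶠ (Vᶠ i a ∧ᶠ Aᶠ (Xᵖ past (st (Eag a φ)))))
      ∨ᶠ Aᶠ (Fᵖ past (bindᵖ t (st (var tv ≐ var t))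
                       ∧ᵖ (st (Vᶠ i a) ∧ᵖ st (Aᶠ (Xᵖ past (st (Eag a φ))))))))
    × Sat M s τ
        (Aᶠ (Gᵖ past (bindᵖ t (st
          (((var t ≽ var tb) ∧ᶠ (var t ≼ var tv)) ⇒ᶠ (φ ⇒ᶠ Vᶠ i a))))))

-- Take ψ := ⊥. Seeing to it that ⊥ is impossible at any state with a successor,
-- and the state one step back along a path always has one; hence Viol for ⊥
-- fails at every state lying on a path. Viol for a proposition p holds in the
-- ℕ-chain where p is true exactly at state 1: at state 1 the agent has just
-- seen to it that p from the root, where p is false.
module Submission where

open import Defs
open import Data.Product using (Σ; ∃; _×_; _,_)
open import Relation.Nullary using (¬_)
open import Data.Nat using (ℕ; zero; suc)
open import Data.Sum using (inj₁; inj₂)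
open import Data.Unit using (⊤; tt)
open import Data.Empty using (⊥-elim)
open import Relation.Binary.PropositionalEquality using (_≡_; refl; subst; sym)

⊥ᶠ : SForm
⊥ᶠ = ¬ᶠ ⊤ᶠ

⊥ᶠ-implies : ∀ φ → Valid (⊥ᶠ ⇒ᶠ φ)
⊥ᶠ-implies φ _ _ _ ¬⊤ = ⊥-elim (¬⊤ tt)

module _ {M : Model} where
  open Model M

  ¬-sees-⊥ᶠ : ∀ {s s'} τ a → R s s' → ¬ Sat M s τ (Eag a ⊥ᶠ)
  ¬-sees-⊥ᶠ τ a s→s' (all-succ , _ , _) = all-succ _ s→s' tt

  ¬-X⁻-sees-⊥ᶠ : ∀ (p : Path M) j τ a → ¬ SatP M p j τ (Xᵖ past (st (Eag a ⊥ᶠ)))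
  ¬-X⁻-sees-⊥ᶠ p zero    τ a ()
  ¬-X⁻-sees-⊥ᶠ p (suc j) τ a = ¬-sees-⊥ᶠ τ a (step p j)

  ¬ViolAct-⊥ᶠ : ∀ {s} τ i a tb tv (p : Path M) → p ∈paths s → ¬ ViolAct M s τ i a tb tv ⊥ᶠ
  ¬ViolAct-⊥ᶠ {s} τ _ a _ _ p p∋s (inj₁ (_ , _ , A-X⁻) , _) =
    ¬-X⁻-sees-⊥ᶠ p (depth s) _ a (A-X⁻ p p∋s)
  ¬ViolAct-⊥ᶠ τ _ a _ _ p p∋s (inj₂ A-F⁻ , _) with A-F⁻ p p∋s
  ... | k , _ , _ , _ , A-X⁻ = ¬-X⁻-sees-⊥ᶠ p (depth (σ p k)) _ a (A-X⁻ p (k , refl))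

chain : Model
chain = record
  { W = ℕ ; root = 0 ; R = λ n m → m ≡ suc n ; depth = λ n → n
  ; depth-root = refl ; depth-step = λ n→m → n→m
  ; parent = parent ; parent-unique = λ { refl refl → refl }
  ; T = λ _ _ _ → ⊤ ; val = λ _ n → n ≡ 1
  ; V = λ _ _ _ → ⊤ ; D = λ _ _ _ → ⊤ ; Rep = λ _ _ _ → ⊤ ; Pun = λ _ _ _ → ⊤ }
  where
  parent : ∀ n → ¬ n ≡ 0 → ∃ λ m → n ≡ suc m
  parent zero    n≢0 = ⊥-elim (n≢0 refl)
  parent (suc m) _   = m , refl

chain-path : Path chain
chain-path = record { σ = λ n → n ; start = refl ; step = λ _ → refl }

root-sees-prop : ∀ τ a x → Sat chain 0 τ (Eag a (prop x))
root-sees-prop τ a x = (λ _ 0→s' → 0→s') , (1 , refl , tt) , λ always → 0≢1 (always chain-path 0)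
  where
  0≢1 : ¬ 0 ≡ 1
  0≢1 ()

-- tv := 0 is pinned to the time 1 of the violation; the fresh variable is 1.
ViolAct-prop-at-1 : ∀ i a x → ViolAct chain 1 (λ _ → 1) i a 0 0 (prop x)
ViolAct-prop-at-1 i a x = inj₁ (refl , tt , sees-one-step-back) , λ _ _ _ _ _ _ → tt
  where
  τ₁ : Assignment
  τ₁ = (λ _ → 1) [ 1 ≔ 1 ]

  sees-one-step-back : ∀ (p : Path chain) → p ∈paths 1 →
    SatP chain p 1 τ₁ (Xᵖ past (st (Eag a (prop x))))
  sees-one-step-back p _ =
    subst (λ w → Sat chain w τ₁ (Eag a (prop x))) (sym (start p)) (root-sees-prop τ₁ a x)

proposition4p7 : Σ Model λ M → ∃ λ (s : Model.W M) → ∃ λ (τ : Assignment) →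
    ∃ λ (i : Label) → ∃ λ (a : Agent) → ∃ λ (tb : TVar) → ∃ λ (tv : TVar) →
    ∃ λ (φ : SForm) → ∃ λ (ψ : SForm) →
      Valid (ψ ⇒ᶠ φ) × ViolAct M s τ i a tb tv φ × ¬ ViolAct M s τ i a tb tv ψ
proposition4p7 =
  chain , 1 , (λ _ → 1) , 0 , 0 , 0 , 0 , prop 0 , ⊥ᶠ
  , ⊥ᶠ-implies (prop 0)
  , ViolAct-prop-at-1 0 0 0
  , ¬ViolAct-⊥ᶠ (λ _ → 1) 0 0 0 0 chain-path (1 , refl)
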